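{- Let $F$ be a finite collection of finite nonempty sets. Then $F$ is an hke collection if and only if for every subcollection $\Gamma$ of $F$ with at least two members there exists a partition $\{\Gamma_1,\Gamma_2\}$ of $\Gamma$ into two non-empty subcollections such that $$\Big|\bigcap\Gamma_1-\bigcup\Gamma_2\Big|=\Big|\bigcap\Gamma_2-\bigcup\Gamma_1\Big|.$$
   Context: A collection $F$ of sets is an hereditary Konig–Egervary (hke) collection if there is a positive integer $\alpha$ such that $|\bigcup\Gamma|+|\bigcap\Gamma|=2\alpha$ for every non-empty subcollection $\Gamma\subseteq F$. -}

module Defs where

open import Data.Nat using (ℕ; zero; suc; _+_; _*_; _≤_)
open import Data.Bool using (true; false)
open import Data.Fin using (Fin)
open import Data.Fin.Subset using (Subset; ⋃; ⋂; ∣_∣; Nonempty; _∩_; _∪_; _─_; ⊥; Empty)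
open import Data.Vec using (Vec; []; _∷_)
open import Data.List using (List; []; _∷_)
open import Data.Product using (∃; _×_)
open import Function using (_∘_; Injective)
open import Relation.Binary.PropositionalEquality using (_≡_)

-- A finite collection of m finite sets over a finite ground set Fin n,
-- given as an injective family  F : Fin m → Subset n  (distinct members).
-- A subcollection Γ is a subset of the index set Fin m.

members : ∀ {n m} → (Fin m → Subset n) → Subset m → List (Subset n)
members {m = zero}  F []          = []
members {m = suc m} F (true ∷ Γ)  = F Fin.zero ∷ members (F ∘ Fin.suc) Γ
members {m = suc m} F (false ∷ Γ) = members (F ∘ Fin.suc) Γ

-- ⋃Γ and ⋂Γ (the latter only used for non-empty Γ)
BigUnion : ∀ {n m} → (Fin m → Subset n) → Subset m → Subset n
BigUnion F Γ = ⋃ (members F Γ)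

BigInter : ∀ {n m} → (Fin m → Subset n) → Subset m → Subset n
BigInter F Γ = ⋂ (members F Γ)

IsHKE : ∀ {n m} → (Fin m → Subset n) → Set
IsHKE {n} {m} F =
  ∃ λ (α : ℕ) → 1 ≤ α ×
    ((Γ : Subset m) → Nonempty Γ →
       ∣ BigUnion F Γ ∣ + ∣ BigInter F Γ ∣ ≡ 2 * α)

IsPartition2 : ∀ {m} → Subset m → Subset m → Subset m → Set
IsPartition2 Γ Γ₁ Γ₂ =
  Nonempty Γ₁ × Nonempty Γ₂ × (Γ₁ ∩ Γ₂ ≡ ⊥) × (Γ₁ ∪ Γ₂ ≡ Γ)

SplitCondition : ∀ {n m} → (Fin m → Subset n) → Set
SplitCondition {n} {m} F =
  (Γ : Subset m) → 2 ≤ ∣ Γ ∣ →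
    ∃ λ (Γ₁ : Subset m) → ∃ λ (Γ₂ : Subset m) →
      IsPartition2 Γ Γ₁ Γ₂ ×
      (∣ BigInter F Γ₁ ─ BigUnion F Γ₂ ∣ ≡ ∣ BigInter F Γ₂ ─ BigUnion F Γ₁ ∣)

-- Write w Γ = |⋃Γ| + |⋂Γ| and e(Γ₁, Γ₂) = |⋂Γ₁ − ⋃Γ₂|.  Counting elements gives
--   w(⁅A⁆ ∪ Γ) + e(Γ, ⁅A⁆) = w Γ + e(⁅A⁆, Γ)   and   e(Γ₁ ∪ ⁅A⁆, Γ₂) + e(Γ₁, Γ₂ ∪ ⁅A⁆) = e(Γ₁, Γ₂).
-- So if every non-empty proper subcollection of Γ = Γ₁ ⊔ Γ₂ has weight c, moving the members of Γ₁
-- into Γ₂ one at a time shows  w Γ = c ⇔ e(Γ₁, Γ₂) = e(Γ₂, Γ₁).  Both directions of the theorem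
-- follow by strong induction on Γ; for the converse the split condition on pairs forces all |F i|
-- to be equal, which fixes the weight 2|F i| of the singletons.

module Submission where

open import Defs
open import Algebra.Bundles using (IdempotentCommutativeMonoid)
open import Algebra.Core using (Op₂)
open import Algebra.Structures using (IsIdempotentCommutativeMonoid)
import Algebra.Solver.IdempotentCommutativeMonoid as ICM-Solver
open import Data.Bool.Base using (true; false)
open import Data.Bool.Properties using (∨-identityʳ)
open import Data.Empty using (⊥-elim)
open import Data.Fin.Base using (Fin; zero; suc)
open import Data.Fin.Properties using (_≟_)
open import Data.Fin.Subset
open import Data.Fin.Subset.Properties
open import Data.List.Base using ([]; _∷_; foldr)
open import Data.Nat.Base using (ℕ; zero; suc; _+_; _*_; _≤_; _<_; s≤s)
open import Data.Nat.Induction using (<-wellFounded)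
open import Data.Nat.Properties using (+-suc; +-comm; +-identityʳ; +-cancelˡ-≡; +-cancelʳ-≡; ≤-refl; ≤-trans; n≮0; n≮n)
open import Data.Nat.Tactic.RingSolver using (solve-∀)
open import Data.Product using (∃; _×_; _,_)
open import Data.Sum using (_⊎_; inj₁; inj₂; [_,_]; swap; map₁)
import Data.Sum as Sum
open import Data.Vec.Base using ([]; _∷_; here; there)
open import Function.Base using (_∘_)
open import Function.Bundles using (_⇔_; mk⇔; Equivalence)
open import Function.Definitions using (Injective)
import Function.Properties.Equivalence as ⇔
open import Induction.WellFounded using (WellFounded; Acc; acc; module Subrelation)
open import Relation.Binary.Construct.On as On using ()
open import Relation.Binary.PropositionalEquality hiding ([_])
open import Relation.Nullary using (yes; no)

∣p∣≡∣p∩q∣+∣p─q∣ : ∀ {n} (p q : Subset n) → ∣ p ∣ ≡ ∣ p ∩ q ∣ + ∣ p ─ q ∣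
∣p∣≡∣p∩q∣+∣p─q∣ []          []          = refl
∣p∣≡∣p∩q∣+∣p─q∣ (true  ∷ p) (true  ∷ q) = cong suc (∣p∣≡∣p∩q∣+∣p─q∣ p q)
∣p∣≡∣p∩q∣+∣p─q∣ (true  ∷ p) (false ∷ q) = trans (cong suc (∣p∣≡∣p∩q∣+∣p─q∣ p q)) (sym (+-suc _ _))
∣p∣≡∣p∩q∣+∣p─q∣ (false ∷ p) (true  ∷ q) = ∣p∣≡∣p∩q∣+∣p─q∣ p q
∣p∣≡∣p∩q∣+∣p─q∣ (false ∷ p) (false ∷ q) = ∣p∣≡∣p∩q∣+∣p─q∣ p q

∣p∪q∣≡∣q∣+∣p─q∣ : ∀ {n} (p q : Subset n) → ∣ p ∪ q ∣ ≡ ∣ q ∣ + ∣ p ─ q ∣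
∣p∪q∣≡∣q∣+∣p─q∣ []          []          = refl
∣p∪q∣≡∣q∣+∣p─q∣ (true  ∷ p) (true  ∷ q) = cong suc (∣p∪q∣≡∣q∣+∣p─q∣ p q)
∣p∪q∣≡∣q∣+∣p─q∣ (true  ∷ p) (false ∷ q) = trans (cong suc (∣p∪q∣≡∣q∣+∣p─q∣ p q)) (sym (+-suc _ _))
∣p∪q∣≡∣q∣+∣p─q∣ (false ∷ p) (true  ∷ q) = cong suc (∣p∪q∣≡∣q∣+∣p─q∣ p q)
∣p∪q∣≡∣q∣+∣p─q∣ (false ∷ p) (false ∷ q) = ∣p∪q∣≡∣q∣+∣p─q∣ p q

∣p─q∣≡∣q─p∣⇒∣p∣≡∣q∣ : ∀ {n} (p q : Subset n) → ∣ p ─ q ∣ ≡ ∣ q ─ p ∣ → ∣ p ∣ ≡ ∣ q ∣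
∣p─q∣≡∣q─p∣⇒∣p∣≡∣q∣ p q eq = begin
  ∣ p ∣                   ≡⟨ ∣p∣≡∣p∩q∣+∣p─q∣ p q ⟩
  ∣ p ∩ q ∣ + ∣ p ─ q ∣   ≡⟨ cong₂ _+_ (cong ∣_∣ (∩-comm p q)) eq ⟩
  ∣ q ∩ p ∣ + ∣ q ─ p ∣   ≡⟨ ∣p∣≡∣p∩q∣+∣p─q∣ q p ⟨
  ∣ q ∣                   ∎
  where open ≡-Reasoning

∣p∪q∣+∣p∩r∣+∣r─p∣≡∣q∣+∣r∣+∣p─q∣ : ∀ {n} (p q r : Subset n) →
                                   ∣ p ∪ q ∣ + ∣ p ∩ r ∣ + ∣ r ─ p ∣ ≡ ∣ q ∣ + ∣ r ∣ + ∣ p ─ q ∣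
∣p∪q∣+∣p∩r∣+∣r─p∣≡∣q∣+∣r∣+∣p─q∣ p q r = begin
  ∣ p ∪ q ∣ + ∣ p ∩ r ∣ + ∣ r ─ p ∣               ≡⟨ cong₂ (λ s t → s + t + ∣ r ─ p ∣) (∣p∪q∣≡∣q∣+∣p─q∣ p q) (cong ∣_∣ (∩-comm p r)) ⟩
  ∣ q ∣ + ∣ p ─ q ∣ + ∣ r ∩ p ∣ + ∣ r ─ p ∣       ≡⟨ regroup (∣ q ∣) (∣ p ─ q ∣) (∣ r ∩ p ∣) (∣ r ─ p ∣) ⟩
  ∣ q ∣ + (∣ r ∩ p ∣ + ∣ r ─ p ∣) + ∣ p ─ q ∣     ≡⟨ cong (λ t → ∣ q ∣ + t + ∣ p ─ q ∣) (∣p∣≡∣p∩q∣+∣p─q∣ r p) ⟨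
  ∣ q ∣ + ∣ r ∣ + ∣ p ─ q ∣                       ∎
  where
  open ≡-Reasoning
  regroup : ∀ a b c d → a + b + c + d ≡ a + (c + d) + b
  regroup = solve-∀

p─q∩r≡p∩r─q : ∀ {n} (p q r : Subset n) → (p ─ q) ∩ r ≡ (p ∩ r) ─ q
p─q∩r≡p∩r─q []      []          []      = refl
p─q∩r≡p∩r─q (_ ∷ p) (true  ∷ q) (_ ∷ r) = cong (false ∷_) (p─q∩r≡p∩r─q p q r)
p─q∩r≡p∩r─q (_ ∷ p) (false ∷ q) (_ ∷ r) = cong (_ ∷_) (p─q∩r≡p∩r─q p q r)

∣p∩r─q∣+∣p─q∪r∣≡∣p─q∣ : ∀ {n} (p q r : Subset n) → ∣ (p ∩ r) ─ q ∣ + ∣ p ─ (q ∪ r) ∣ ≡ ∣ p ─ q ∣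
∣p∩r─q∣+∣p─q∪r∣≡∣p─q∣ p q r = begin
  ∣ (p ∩ r) ─ q ∣ + ∣ p ─ (q ∪ r) ∣   ≡⟨ cong₂ (λ s t → ∣ s ∣ + ∣ t ∣) (p─q∩r≡p∩r─q p q r) (p─q─r≡p─q∪r p q r) ⟨
  ∣ (p ─ q) ∩ r ∣ + ∣ p ─ q ─ r ∣     ≡⟨ ∣p∣≡∣p∩q∣+∣p─q∣ (p ─ q) r ⟨
  ∣ p ─ q ∣                           ∎
  where open ≡-Reasoning

x∈p─q⇒x∉q : ∀ {n} {x : Fin n} {p q : Subset n} → x ∈ p ─ q → x ∉ q
x∈p─q⇒x∉q {p = _ ∷ p} {false ∷ q} here          ()
x∈p─q⇒x∉q {p = _ ∷ p} {_     ∷ q} (there x∈p─q) (there x∈q) = x∈p─q⇒x∉q x∈p─q x∈q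

x∈p⇒p-x∪⁅x⁆≡p : ∀ {n} {x : Fin n} {p : Subset n} → x ∈ p → (p - x) ∪ ⁅ x ⁆ ≡ p
x∈p⇒p-x∪⁅x⁆≡p {p = true ∷ p} here        = cong (true ∷_) (trans (∪-identityʳ _) (p─⊥≡p p))
x∈p⇒p-x∪⁅x⁆≡p {p = b    ∷ p} (there x∈p) = cong₂ _∷_ (∨-identityʳ b) (x∈p⇒p-x∪⁅x⁆≡p x∈p)

Empty[p-x]⇒p≡⁅x⁆ : ∀ {n} {x : Fin n} {p : Subset n} → x ∈ p → Empty (p - x) → p ≡ ⁅ x ⁆
Empty[p-x]⇒p≡⁅x⁆ {x = x} {p} x∈p empty = begin
  p                  ≡⟨ x∈p⇒p-x∪⁅x⁆≡p x∈p ⟨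
  (p - x) ∪ ⁅ x ⁆    ≡⟨ cong (_∪ ⁅ x ⁆) (Empty-unique empty) ⟩
  ⊥ ∪ ⁅ x ⁆          ≡⟨ ∪-identityˡ ⁅ x ⁆ ⟩
  ⁅ x ⁆              ∎
  where open ≡-Reasoning

Nonempty⇒∣p∣>0 : ∀ {n} {p : Subset n} → Nonempty p → 0 < ∣ p ∣
Nonempty⇒∣p∣>0 {n} {p} (x , x∈p) = subst (_< ∣ p ∣) (∣⊥∣≡0 n) (p⊂q⇒∣p∣<∣q∣ (⊆-min p , x , x∈p , ∉⊥))

2≤∣p∣⇒Nonempty[p-x] : ∀ {n} {p : Subset n} → 2 ≤ ∣ p ∣ → ∃ λ x → x ∈ p × Nonempty (p - x)
2≤∣p∣⇒Nonempty[p-x] {n} {p} 2≤∣p∣ with nonempty? p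
... | no empty = ⊥-elim (n≮0 (subst (2 ≤_) (trans (cong ∣_∣ (Empty-unique empty)) (∣⊥∣≡0 n)) 2≤∣p∣))
... | yes (x , x∈p) with nonempty? (p - x)
...   | yes ne    = x , x∈p , ne
...   | no  empty = ⊥-elim (n≮n 1 (subst (2 ≤_) (trans (cong ∣_∣ (Empty[p-x]⇒p≡⁅x⁆ x∈p empty)) (∣⁅x⁆∣≡1 x)) 2≤∣p∣))

Nonempty[p-x]⇒2≤∣p∣ : ∀ {n} {x : Fin n} {p : Subset n} → x ∈ p → Nonempty (p - x) → 2 ≤ ∣ p ∣
Nonempty[p-x]⇒2≤∣p∣ x∈p ne = ≤-trans (s≤s (Nonempty⇒∣p∣>0 ne)) (x∈p⇒∣p-x∣<∣p∣ x∈p)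

p-x∪q⊂p∪q : ∀ {n} {x : Fin n} {p q : Subset n} → x ∈ p → x ∉ q → (p - x) ∪ q ⊂ p ∪ q
p-x∪q⊂p∪q {x = x} {p} {q} x∈p x∉q = p-x∪q⊆p∪q , x , x∈p∪q⁺ (inj₁ x∈p) , x∉p-x∪q
  where
  p-x∪q⊆p∪q : (p - x) ∪ q ⊆ p ∪ q
  p-x∪q⊆p∪q y∈ = x∈p∪q⁺ (map₁ (p─q⊆p p ⁅ x ⁆) (x∈p∪q⁻ (p - x) q y∈))
  x∉p-x∪q : x ∉ (p - x) ∪ q
  x∉p-x∪q x∈ = [ (λ x∈p-x → x∈p─q⇒x∉q x∈p-x (x∈⁅x⁆ x)) , x∉q ] (x∈p∪q⁻ (p - x) q x∈)

2≤∣⁅x⁆∪⁅y⁆∣ : ∀ {n} {x y : Fin n} → x ≢ y → 2 ≤ ∣ ⁅ x ⁆ ∪ ⁅ y ⁆ ∣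
2≤∣⁅x⁆∪⁅y⁆∣ {x = x} {y} x≢y =
  subst (_< ∣ ⁅ x ⁆ ∪ ⁅ y ⁆ ∣) (∣⁅x⁆∣≡1 x)
        (p⊂q⇒∣p∣<∣q∣ (p⊆p∪q ⁅ y ⁆ , y , x∈p∪q⁺ (inj₂ (x∈⁅x⁆ y)) , x≢y⇒x∉⁅y⁆ (x≢y ∘ sym)))

⊂-wellFounded : ∀ {n} → WellFounded (_⊂_ {n})
⊂-wellFounded = Subrelation.wellFounded p⊂q⇒∣p∣<∣q∣ (On.wellFounded ∣_∣ <-wellFounded)

Disjoint : ∀ {n} → Subset n → Subset n → Set
Disjoint p q = ∀ {x} → x ∈ p → x ∉ q

∩≡⊥⇒Disjoint : ∀ {n} {p q : Subset n} → p ∩ q ≡ ⊥ → Disjoint p q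
∩≡⊥⇒Disjoint p∩q≡⊥ x∈p x∈q = ∉⊥ (subst (_ ∈_) p∩q≡⊥ (x∈p∩q⁺ (x∈p , x∈q)))

Disjoint⇒∩≡⊥ : ∀ {n} {p q : Subset n} → Disjoint p q → p ∩ q ≡ ⊥
Disjoint⇒∩≡⊥ {p = p} {q} disjoint = ⊆-antisym p∩q⊆⊥ (⊆-min (p ∩ q))
  where
  p∩q⊆⊥ : p ∩ q ⊆ ⊥
  p∩q⊆⊥ x∈p∩q with x∈p∩q⁻ p q x∈p∩q
  ... | x∈p , x∈q = ⊥-elim (disjoint x∈p x∈q)

x∈⁅i⁆∪⁅j⁆⇒x≡i⊎x≡j : ∀ {n} {x i j : Fin n} → x ∈ ⁅ i ⁆ ∪ ⁅ j ⁆ → x ≡ i ⊎ x ≡ j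
x∈⁅i⁆∪⁅j⁆⇒x≡i⊎x≡j {i = i} {j} x∈ = Sum.map (x∈⁅y⁆⇒x≡y i) (x∈⁅y⁆⇒x≡y j) (x∈p∪q⁻ ⁅ i ⁆ ⁅ j ⁆ x∈)

⊆pair∧∉⇒≡⁅⁆ : ∀ {n} {i j : Fin n} {p : Subset n} →
              (∀ {x} → x ∈ p → x ≡ i ⊎ x ≡ j) → i ∈ p → j ∉ p → p ≡ ⁅ i ⁆
⊆pair∧∉⇒≡⁅⁆ {i = i} {j} {p} inPair i∈p j∉p = ⊆-antisym p⊆⁅i⁆ ⁅i⁆⊆p
  where
  p⊆⁅i⁆ : p ⊆ ⁅ i ⁆
  p⊆⁅i⁆ x∈p with inPair x∈p
  ... | inj₁ refl = x∈⁅x⁆ i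
  ... | inj₂ refl = ⊥-elim (j∉p x∈p)
  ⁅i⁆⊆p : ⁅ i ⁆ ⊆ p
  ⁅i⁆⊆p x∈⁅i⁆ = subst (_∈ p) (sym (x∈⁅y⁆⇒x≡y i x∈⁅i⁆)) i∈p

partition-of-pair : ∀ {n} {i j : Fin n} {Γ₁ Γ₂ : Subset n} → IsPartition2 (⁅ i ⁆ ∪ ⁅ j ⁆) Γ₁ Γ₂ →
                    (Γ₁ ≡ ⁅ i ⁆ × Γ₂ ≡ ⁅ j ⁆) ⊎ (Γ₁ ≡ ⁅ j ⁆ × Γ₂ ≡ ⁅ i ⁆)
partition-of-pair {i = i} {j} {Γ₁} {Γ₂} ((a , a∈Γ₁) , (b , b∈Γ₂) , Γ₁∩Γ₂≡⊥ , Γ₁∪Γ₂≡pair) =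
  classify (inPair₁ a∈Γ₁) (inPair₂ b∈Γ₂)
  where
  disjoint : Disjoint Γ₁ Γ₂
  disjoint = ∩≡⊥⇒Disjoint Γ₁∩Γ₂≡⊥
  inPair₁ : ∀ {x} → x ∈ Γ₁ → x ≡ i ⊎ x ≡ j
  inPair₁ x∈Γ₁ = x∈⁅i⁆∪⁅j⁆⇒x≡i⊎x≡j (subst (_ ∈_) Γ₁∪Γ₂≡pair (x∈p∪q⁺ (inj₁ x∈Γ₁)))
  inPair₂ : ∀ {x} → x ∈ Γ₂ → x ≡ i ⊎ x ≡ j
  inPair₂ x∈Γ₂ = x∈⁅i⁆∪⁅j⁆⇒x≡i⊎x≡j (subst (_ ∈_) Γ₁∪Γ₂≡pair (x∈p∪q⁺ (inj₂ x∈Γ₂)))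
  classify : a ≡ i ⊎ a ≡ j → b ≡ i ⊎ b ≡ j → (Γ₁ ≡ ⁅ i ⁆ × Γ₂ ≡ ⁅ j ⁆) ⊎ (Γ₁ ≡ ⁅ j ⁆ × Γ₂ ≡ ⁅ i ⁆)
  classify (inj₁ refl) (inj₂ refl) = inj₁ ( ⊆pair∧∉⇒≡⁅⁆ inPair₁ a∈Γ₁ (λ b∈Γ₁ → disjoint b∈Γ₁ b∈Γ₂)
                                          , ⊆pair∧∉⇒≡⁅⁆ (swap ∘ inPair₂) b∈Γ₂ (disjoint a∈Γ₁))
  classify (inj₂ refl) (inj₁ refl) = inj₂ ( ⊆pair∧∉⇒≡⁅⁆ (swap ∘ inPair₁) a∈Γ₁ (λ b∈Γ₁ → disjoint b∈Γ₁ b∈Γ₂)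
                                          , ⊆pair∧∉⇒≡⁅⁆ inPair₂ b∈Γ₂ (disjoint a∈Γ₁))
  classify (inj₁ refl) (inj₁ refl) = ⊥-elim (disjoint a∈Γ₁ b∈Γ₂)
  classify (inj₂ refl) (inj₂ refl) = ⊥-elim (disjoint a∈Γ₁ b∈Γ₂)

module BigOperator {n : ℕ} {_∙_ : Op₂ (Subset n)} {ε : Subset n}
                   (isICM : IsIdempotentCommutativeMonoid _≡_ _∙_ ε) where

  private
    icm : IdempotentCommutativeMonoid _ _
    icm = record { isIdempotentCommutativeMonoid = isICM }
  open IdempotentCommutativeMonoid icm using (identityʳ; idem)
  open ICM-Solver icm

  big : ∀ {m} → (Fin m → Subset n) → Subset m → Subset n
  big F Γ = foldr _∙_ ε (members F Γ)

  big-⊥ : ∀ {m} (F : Fin m → Subset n) → big F ⊥ ≡ ε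
  big-⊥ {zero}  F = refl
  big-⊥ {suc m} F = big-⊥ (F ∘ suc)

  big-⁅⁆ : ∀ {m} (F : Fin m → Subset n) (i : Fin m) → big F ⁅ i ⁆ ≡ F i
  big-⁅⁆ F zero    = trans (cong (F zero ∙_) (big-⊥ (F ∘ suc))) (identityʳ (F zero))
  big-⁅⁆ F (suc i) = big-⁅⁆ (F ∘ suc) i

  big-∪ : ∀ {m} (F : Fin m → Subset n) (X Y : Subset m) → big F (X ∪ Y) ≡ big F X ∙ big F Y
  big-∪ F []          []          = sym (idem ε)
  big-∪ F (true  ∷ X) (true  ∷ Y) rewrite big-∪ (F ∘ suc) X Y =
    prove 3 (f ⊕ (x ⊕ y)) ((f ⊕ x) ⊕ (f ⊕ y)) (F zero ∷ big (F ∘ suc) X ∷ big (F ∘ suc) Y ∷ [])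
    where f = var zero; x = var (suc zero); y = var (suc (suc zero))
  big-∪ F (true  ∷ X) (false ∷ Y) rewrite big-∪ (F ∘ suc) X Y =
    prove 3 (f ⊕ (x ⊕ y)) ((f ⊕ x) ⊕ y) (F zero ∷ big (F ∘ suc) X ∷ big (F ∘ suc) Y ∷ [])
    where f = var zero; x = var (suc zero); y = var (suc (suc zero))
  big-∪ F (false ∷ X) (true  ∷ Y) rewrite big-∪ (F ∘ suc) X Y =
    prove 3 (f ⊕ (x ⊕ y)) (x ⊕ (f ⊕ y)) (F zero ∷ big (F ∘ suc) X ∷ big (F ∘ suc) Y ∷ [])
    where f = var zero; x = var (suc zero); y = var (suc (suc zero))
  big-∪ F (false ∷ X) (false ∷ Y) = big-∪ (F ∘ suc) X Y

BigUnion-∪ : ∀ {n m} (F : Fin m → Subset n) X Y → BigUnion F (X ∪ Y) ≡ BigUnion F X ∪ BigUnion F Y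
BigUnion-∪ {n} = BigOperator.big-∪ (∪-isIdempotentCommutativeMonoid n)

BigInter-∪ : ∀ {n m} (F : Fin m → Subset n) X Y → BigInter F (X ∪ Y) ≡ BigInter F X ∩ BigInter F Y
BigInter-∪ {n} = BigOperator.big-∪ (∩-isIdempotentCommutativeMonoid n)

BigUnion-⁅⁆ : ∀ {n m} (F : Fin m → Subset n) i → BigUnion F ⁅ i ⁆ ≡ F i
BigUnion-⁅⁆ {n} = BigOperator.big-⁅⁆ (∪-isIdempotentCommutativeMonoid n)

BigInter-⁅⁆ : ∀ {n m} (F : Fin m → Subset n) i → BigInter F ⁅ i ⁆ ≡ F i
BigInter-⁅⁆ {n} = BigOperator.big-⁅⁆ (∩-isIdempotentCommutativeMonoid n)

+-cancel-⇔ : ∀ {a b c d} → a + b ≡ c + d → (a ≡ c ⇔ b ≡ d)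
+-cancel-⇔ {a} {b} {c} {d} eq = mk⇔
  (λ a≡c → +-cancelˡ-≡ c b d (trans (cong (_+ b) (sym a≡c)) eq))
  (λ b≡d → +-cancelʳ-≡ d a c (trans (cong (a +_) (sym b≡d)) eq))

module HKE {n m : ℕ} (F : Fin m → Subset n) where

  weight : Subset m → ℕ
  weight Γ = ∣ BigUnion F Γ ∣ + ∣ BigInter F Γ ∣

  exclusive : Subset m → Subset m → ℕ
  exclusive Γ₁ Γ₂ = ∣ BigInter F Γ₁ ─ BigUnion F Γ₂ ∣

  Balanced : Subset m → Subset m → Set
  Balanced Γ₁ Γ₂ = exclusive Γ₁ Γ₂ ≡ exclusive Γ₂ Γ₁

  UniformBelow : ℕ → Subset m → Set
  UniformBelow c Γ = ∀ Δ → Nonempty Δ → Δ ⊂ Γ → weight Δ ≡ c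

  weight-⁅⁆ : ∀ i → weight ⁅ i ⁆ ≡ 2 * ∣ F i ∣
  weight-⁅⁆ i rewrite BigUnion-⁅⁆ F i | BigInter-⁅⁆ F i = cong (∣ F i ∣ +_) (sym (+-identityʳ _))

  Balanced-⁅⁆⇒∣F∣≡ : ∀ i j → Balanced ⁅ i ⁆ ⁅ j ⁆ → ∣ F i ∣ ≡ ∣ F j ∣
  Balanced-⁅⁆⇒∣F∣≡ i j balanced
    rewrite BigUnion-⁅⁆ F i | BigInter-⁅⁆ F i | BigUnion-⁅⁆ F j | BigInter-⁅⁆ F j
    = ∣p─q∣≡∣q─p∣⇒∣p∣≡∣q∣ (F i) (F j) balanced

  weight-insert : ∀ A Γ → weight (⁅ A ⁆ ∪ Γ) + exclusive Γ ⁅ A ⁆ ≡ weight Γ + exclusive ⁅ A ⁆ Γ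
  weight-insert A Γ rewrite BigUnion-∪ F ⁅ A ⁆ Γ | BigInter-∪ F ⁅ A ⁆ Γ | BigUnion-⁅⁆ F A | BigInter-⁅⁆ F A
    = ∣p∪q∣+∣p∩r∣+∣r─p∣≡∣q∣+∣r∣+∣p─q∣ (F A) (BigUnion F Γ) (BigInter F Γ)

  exclusive-split : ∀ Γ₁ Γ₂ A → exclusive (Γ₁ ∪ ⁅ A ⁆) Γ₂ + exclusive Γ₁ (Γ₂ ∪ ⁅ A ⁆) ≡ exclusive Γ₁ Γ₂
  exclusive-split Γ₁ Γ₂ A rewrite BigInter-∪ F Γ₁ ⁅ A ⁆ | BigUnion-∪ F Γ₂ ⁅ A ⁆ | BigInter-⁅⁆ F A | BigUnion-⁅⁆ F A
    = ∣p∩r─q∣+∣p─q∪r∣≡∣p─q∣ (BigInter F Γ₁) (BigUnion F Γ₂) (F A)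

  weight⇔Balanced-singleton : ∀ {c} A Γ → weight Γ ≡ c → weight (⁅ A ⁆ ∪ Γ) ≡ c ⇔ Balanced ⁅ A ⁆ Γ
  weight⇔Balanced-singleton A Γ refl = ⇔.trans (+-cancel-⇔ (weight-insert A Γ)) (mk⇔ sym sym)

  weight⇔Balanced-move : ∀ {c} Γ₁ A Γ₂ → Balanced Γ₁ Γ₂ →
                        (weight (Γ₁ ∪ (Γ₂ ∪ ⁅ A ⁆)) ≡ c ⇔ Balanced Γ₁ (Γ₂ ∪ ⁅ A ⁆)) →
                        weight ((Γ₁ ∪ ⁅ A ⁆) ∪ Γ₂) ≡ c ⇔ Balanced (Γ₁ ∪ ⁅ A ⁆) Γ₂
  weight⇔Balanced-move {c} Γ₁ A Γ₂ balanced moved =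
    subst (λ Γ → weight Γ ≡ c ⇔ Balanced (Γ₁ ∪ ⁅ A ⁆) Γ₂) same-union (⇔.trans moved (⇔.sym (+-cancel-⇔ exchange)))
    where
    open ≡-Reasoning
    same-union : Γ₁ ∪ (Γ₂ ∪ ⁅ A ⁆) ≡ (Γ₁ ∪ ⁅ A ⁆) ∪ Γ₂
    same-union = trans (cong (Γ₁ ∪_) (∪-comm Γ₂ ⁅ A ⁆)) (sym (∪-assoc Γ₁ ⁅ A ⁆ Γ₂))
    exchange : exclusive (Γ₁ ∪ ⁅ A ⁆) Γ₂ + exclusive Γ₁ (Γ₂ ∪ ⁅ A ⁆)
             ≡ exclusive Γ₂ (Γ₁ ∪ ⁅ A ⁆) + exclusive (Γ₂ ∪ ⁅ A ⁆) Γ₁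
    exchange = begin
      exclusive (Γ₁ ∪ ⁅ A ⁆) Γ₂ + exclusive Γ₁ (Γ₂ ∪ ⁅ A ⁆)  ≡⟨ exclusive-split Γ₁ Γ₂ A ⟩
      exclusive Γ₁ Γ₂                                       ≡⟨ balanced ⟩
      exclusive Γ₂ Γ₁                                       ≡⟨ exclusive-split Γ₂ Γ₁ A ⟨
      exclusive (Γ₂ ∪ ⁅ A ⁆) Γ₁ + exclusive Γ₂ (Γ₁ ∪ ⁅ A ⁆)  ≡⟨ +-comm (exclusive (Γ₂ ∪ ⁅ A ⁆) Γ₁) _ ⟩
      exclusive Γ₂ (Γ₁ ∪ ⁅ A ⁆) + exclusive (Γ₂ ∪ ⁅ A ⁆) Γ₁  ∎

  weight⇔Balanced : ∀ {c} Γ₁ → Acc _⊂_ Γ₁ → ∀ Γ₂ → Nonempty Γ₁ → Nonempty Γ₂ → Disjoint Γ₁ Γ₂ →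
                    UniformBelow c (Γ₁ ∪ Γ₂) → weight (Γ₁ ∪ Γ₂) ≡ c ⇔ Balanced Γ₁ Γ₂
  weight⇔Balanced {c} Γ₁ (acc rs) Γ₂ (A , A∈Γ₁) ne₂ disjoint uniform with nonempty? (Γ₁ - A)
  ... | no empty = subst (λ Γ → weight (Γ ∪ Γ₂) ≡ c ⇔ Balanced Γ Γ₂) (sym (Empty[p-x]⇒p≡⁅x⁆ A∈Γ₁ empty))
                         (weight⇔Balanced-singleton A Γ₂ (uniform Γ₂ ne₂ Γ₂⊂Γ₁∪Γ₂))
    where
    Γ₂⊂Γ₁∪Γ₂ : Γ₂ ⊂ Γ₁ ∪ Γ₂
    Γ₂⊂Γ₁∪Γ₂ = q⊆p∪q Γ₁ Γ₂ , A , x∈p∪q⁺ (inj₁ A∈Γ₁) , disjoint A∈Γ₁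
  ... | yes (x , x∈Γ₁-A) = subst (λ Γ → weight (Γ ∪ Γ₂) ≡ c ⇔ Balanced Γ Γ₂) (x∈p⇒p-x∪⁅x⁆≡p A∈Γ₁)
                                 (weight⇔Balanced-move (Γ₁ - A) A Γ₂ balanced moved)
    where
    Γ₁-A⊆Γ₁ : Γ₁ - A ⊆ Γ₁
    Γ₁-A⊆Γ₁ = p─q⊆p Γ₁ ⁅ A ⁆
    balanced : Balanced (Γ₁ - A) Γ₂
    balanced = Equivalence.to
      (weight⇔Balanced (Γ₁ - A) (rs (x∈p⇒p-x⊂p A∈Γ₁)) Γ₂ (x , x∈Γ₁-A) ne₂ (disjoint ∘ Γ₁-A⊆Γ₁)
         (λ Δ neΔ Δ⊂ → uniform Δ neΔ (⊂-trans Δ⊂ (p-x∪q⊂p∪q A∈Γ₁ (disjoint A∈Γ₁)))))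
      (uniform _ (x , x∈p∪q⁺ (inj₁ x∈Γ₁-A)) (p-x∪q⊂p∪q A∈Γ₁ (disjoint A∈Γ₁)))
    same-union : (Γ₁ - A) ∪ (Γ₂ ∪ ⁅ A ⁆) ≡ Γ₁ ∪ Γ₂
    same-union = trans (trans (cong ((Γ₁ - A) ∪_) (∪-comm Γ₂ ⁅ A ⁆)) (sym (∪-assoc (Γ₁ - A) ⁅ A ⁆ Γ₂)))
                       (cong (_∪ Γ₂) (x∈p⇒p-x∪⁅x⁆≡p A∈Γ₁))
    disjoint′ : Disjoint (Γ₁ - A) (Γ₂ ∪ ⁅ A ⁆)
    disjoint′ y∈Γ₁-A y∈ = [ disjoint (Γ₁-A⊆Γ₁ y∈Γ₁-A) , x∈p─q⇒x∉q y∈Γ₁-A ] (x∈p∪q⁻ Γ₂ ⁅ A ⁆ y∈)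
    moved : weight ((Γ₁ - A) ∪ (Γ₂ ∪ ⁅ A ⁆)) ≡ c ⇔ Balanced (Γ₁ - A) (Γ₂ ∪ ⁅ A ⁆)
    moved = weight⇔Balanced (Γ₁ - A) (rs (x∈p⇒p-x⊂p A∈Γ₁)) (Γ₂ ∪ ⁅ A ⁆) (x , x∈Γ₁-A) (A , q⊆p∪q Γ₂ ⁅ A ⁆ (x∈⁅x⁆ A)) disjoint′
              (subst (UniformBelow c) (sym same-union) uniform)

  Partition⇒weight⇔Balanced : ∀ {c Γ Γ₁ Γ₂} → IsPartition2 Γ Γ₁ Γ₂ → UniformBelow c Γ → weight Γ ≡ c ⇔ Balanced Γ₁ Γ₂
  Partition⇒weight⇔Balanced {Γ₁ = Γ₁} {Γ₂} (ne₁ , ne₂ , Γ₁∩Γ₂≡⊥ , refl) =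
    weight⇔Balanced Γ₁ (⊂-wellFounded Γ₁) Γ₂ ne₁ ne₂ (∩≡⊥⇒Disjoint Γ₁∩Γ₂≡⊥)

  hke⇒split : IsHKE F → SplitCondition F
  hke⇒split (_ , _ , hke) Γ 2≤∣Γ∣ with 2≤∣p∣⇒Nonempty[p-x] 2≤∣Γ∣
  ... | a , a∈Γ , ne = Γ - a , ⁅ a ⁆ , partition ,
                       Equivalence.to (Partition⇒weight⇔Balanced partition (λ Δ neΔ _ → hke Δ neΔ)) (hke Γ (a , a∈Γ))
    where
    partition : IsPartition2 Γ (Γ - a) ⁅ a ⁆
    partition = ne , (a , x∈⁅x⁆ a) , Disjoint⇒∩≡⊥ x∈p─q⇒x∉q , x∈p⇒p-x∪⁅x⁆≡p a∈Γ

  module _ (z : Fin m) (split : SplitCondition F) where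

    ∣F∣-constant : ∀ i → ∣ F i ∣ ≡ ∣ F z ∣
    ∣F∣-constant i with i ≟ z
    ... | yes refl = refl
    ... | no i≢z with split (⁅ i ⁆ ∪ ⁅ z ⁆) (2≤∣⁅x⁆∪⁅y⁆∣ i≢z)
    ...   | Γ₁ , Γ₂ , partition , balanced with partition-of-pair partition
    ...     | inj₁ (refl , refl) = Balanced-⁅⁆⇒∣F∣≡ i z balanced
    ...     | inj₂ (refl , refl) = sym (Balanced-⁅⁆⇒∣F∣≡ z i balanced)

    weight-uniform : ∀ Γ → Acc _⊂_ Γ → Nonempty Γ → weight Γ ≡ 2 * ∣ F z ∣
    weight-uniform Γ (acc rs) (i , i∈Γ) with nonempty? (Γ - i)
    ... | no empty = begin
      weight Γ       ≡⟨ cong weight (Empty[p-x]⇒p≡⁅x⁆ i∈Γ empty) ⟩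
      weight ⁅ i ⁆   ≡⟨ weight-⁅⁆ i ⟩
      2 * ∣ F i ∣    ≡⟨ cong (2 *_) (∣F∣-constant i) ⟩
      2 * ∣ F z ∣    ∎
      where open ≡-Reasoning
    ... | yes ne with split Γ (Nonempty[p-x]⇒2≤∣p∣ i∈Γ ne)
    ...   | Γ₁ , Γ₂ , partition , balanced =
            Equivalence.from (Partition⇒weight⇔Balanced partition (λ Δ neΔ Δ⊂Γ → weight-uniform Δ (rs Δ⊂Γ) neΔ)) balanced

  split⇒hke : ∀ z → Nonempty (F z) → SplitCondition F → IsHKE F
  split⇒hke z ne split = ∣ F z ∣ , Nonempty⇒∣p∣>0 ne , λ Γ → weight-uniform z split Γ (⊂-wellFounded Γ)

theorem3p1 : (n m : ℕ) (F : Fin m → Subset n) →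
    Injective _≡_ _≡_ F →
    ((i : Fin m) → Nonempty (F i)) →
    IsHKE F ⇔ SplitCondition F
theorem3p1 n zero    F _ _        = mk⇔ (HKE.hke⇒split F) (λ _ → 1 , ≤-refl , λ { _ (() , _) })
theorem3p1 n (suc m) F _ nonempty = mk⇔ (HKE.hke⇒split F) (HKE.split⇒hke F zero (nonempty zero))
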